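{- Let $n \geq 2$ be an integer, let $\mathsf{Alist}_n = \langle 1,y_1\rangle \to \langle 2,y_2\rangle \to \cdots \to \langle \mathsf{sr}(n),y_{\mathsf{sr}(n)}\rangle$ with $y_1 = n$, and let $\mathsf{Tchouk}_{n-1} = (b_1,\ldots,b_\ell)$. Then: (a) $\ell = \mathsf{sr}(n)-1$; (b) for $i = 1,2,\ldots,\mathsf{sr}(n)-1$, $b_i = 2i+1+iy_i-(i+1)y_{i+1}$; (c) for $i=1,2,\ldots,\mathsf{sr}(n)$, $y_i = i + \frac{1}{i}\,(b_i + b_{i+1} + \cdots + b_{\mathsf{sr}(n)-1})$ (an empty sum being $0$).
   Context: For $n \in \{1,2,\ldots\}$, $\mathsf{Alist}_n$ is the sequence of integer pairs produced as follows: begin with $\langle 1, n\rangle$, i.e. $y_1=n$. Given the current pair $\langle i, y_i\rangle$ with $y_i > i$, the next pair is $\langle i+1, y_{i+1}\rangle$, where $y_{i+1}$ is the smallest integer with $(i+1)y_{i+1} > i(y_i+1)$. Stop when the current pair $\langle i,y_i\rangle$ satisfies $y_i \leq i$. This process always terminates; its final pair is denoted $\langle \mathsf{sr}(n), y_{\mathsf{sr}(n)}\rangle$, and $\mathsf{sr}(n)$ is called the strange root of $n$. Tchoukaillon solitaire: a board consists of a pit (hole $0$) followed by holes $1,2,3,\ldots$; a configuration $c=(c_1,c_2,\ldots)$ records the number $c_i$ of stones in hole $i$ (the pit is not recorded). A move selects a hole $i$ containing $s_i$ stones, removes them, and puts one stone in each of holes $i-1,i-2,\ldots,i-s_i$ (the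 move is illegal, and the game lost, if $s_i > i$). The game is won if all stones reach the pit. For each $n\ge 0$ there is a unique winning configuration with $n$ stones, denoted $\mathsf{Tchouk}_n$; explicitly $\mathsf{Tchouk}_0 = ()$ and for $n\geq 1$, $\mathsf{Tchouk}_n = (c_1,\ldots,c_\ell)$ where $c_1 = n \bmod 2$ and $c_k = \bigl(n-(c_1+\cdots+c_{k-1})\bigr) \bmod (k+1)$, stopping at the first $\ell$ with $c_1+\cdots+c_\ell = n$ (so $c_\ell \neq 0$, i.e. $\ell$ is the index of the last nonempty hole). For example $\mathsf{Tchouk}_{10} = (0,1,1,3,5)$. -}

module Defs where

open import Data.Nat using (ℕ; zero; suc; _+_; _*_; _∸_; _≤_; _<_)
open import Data.Nat.DivMod using (_/_; _%_)
open import Data.List using (List; []; _∷_; map)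
open import Data.Nat.ListAction using (sum)

-- One step of Alist: given ⟨i, y⟩, the next value is the smallest integer y'
-- with (i+1) y' > i (y+1), i.e. y' = ⌊ i(y+1)/(i+1) ⌋ + 1.
alistStep : ℕ → ℕ → ℕ
alistStep i y = (i * (y + 1)) / suc i + 1

-- alistY n i = y_i of Alist_n (1-indexed; y_1 = n). Index 0 is unused (set to n).
-- The recurrence is extended beyond sr(n); only indices 1..sr(n) are used.
alistY : ℕ → ℕ → ℕ
alistY n zero          = n
alistY n (suc zero)    = n
alistY n (suc (suc i)) = alistStep (suc i) (alistY n (suc i))

IsStrangeRoot : ℕ → ℕ → Set
IsStrangeRoot n s = 1 ≤ s × ((i : ℕ) → 1 ≤ i → i < s → i < alistY n i) × alistY n s ≤ s
  where open import Data.Product using (_×_)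

-- Tchouk_n: c_k = (n - (c_1+…+c_{k-1})) mod (k+1), stopping when the sum reaches n.
-- tchoukGo fuel k r : the holes k, k+1, … given remaining r stones.
tchoukGo : ℕ → ℕ → ℕ → List ℕ
tchoukGo zero     k r       = []
tchoukGo (suc f)  k zero    = []
tchoukGo (suc f)  k (suc r) = let c = suc r % suc k in c ∷ tchoukGo f (suc k) (suc r ∸ c)

-- Fuel n+1 is always sufficient (at most n nonempty holes are produced, since
-- once k ≥ remaining stones, hole k takes all of them).
Tchouk : ℕ → List ℕ
Tchouk n = tchoukGo (suc n) 1 n

-- 1-indexed lookup (0 outside the list).
at : List ℕ → ℕ → ℕ
at []       _             = 0
at (x ∷ xs) zero          = 0
at (x ∷ xs) (suc zero)    = x
at (x ∷ xs) (suc (suc i)) = at xs (suc i)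

range : ℕ → ℕ → List ℕ
range i j = go (suc j ∸ i) i
  where
  go : ℕ → ℕ → List ℕ
  go zero    k = []
  go (suc m) k = k ∷ go m (suc k)

sumFromTo : List ℕ → ℕ → ℕ → ℕ
sumFromTo b i j = sum (map (at b) (range i j))

-- Let r_i be the number of stones that Tchouk_{n-1} puts into holes i, i+1, ….
-- The explicit construction gives r_1 = n - 1 and r_{i+1} = r_i - (r_i mod (i+1)),
-- and induction along Alist_n shows i y_i = i² + r_i: dividing i (y_i + 1) = r_i + i (i+1)
-- by i+1 is exactly the rounding that produces r_{i+1}.  Hence y_i > i iff r_i > 0,
-- which gives (a); b_i = r_i - r_{i+1} gives (b), and summing gives (c).
module Submission where

open import Defs

module Tchoukaillon where

  open import Data.Nat
  open import Data.Nat.Properties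
  open import Data.Nat.DivMod
  open import Data.Nat.Divisibility using (_∣_; divides; n∣m⇒m%n≡0)
  open import Data.List using ([]; _∷_; length; map)
  open import Data.Nat.ListAction using (sum)
  open import Data.Empty using (⊥-elim)
  open import Relation.Binary.PropositionalEquality
  open ≡-Reasoning

  m∸m%n≡m/n*n : ∀ m n .{{_ : NonZero n}} → m ∸ m % n ≡ m / n * n
  m∸m%n≡m/n*n m n = trans (cong (_∸ m % n) (m≡m%n+[m/n]*n m n)) (m+n∸m≡n (m % n) _)

  -- Stones left over once tchoukGo, started at hole k with r stones, has filled holes
  -- k, …, k+j-1; the r_i of the header is remaining 1 (n-1) (i-1).
  remaining : ℕ → ℕ → ℕ → ℕ
  remaining k r zero    = r
  remaining k r (suc j) = remaining (suc k) (r ∸ r % suc k) j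

  remaining-suc : ∀ k r j → remaining k r (suc j) ≡ remaining k r j ∸ remaining k r j % suc (k + j)
  remaining-suc k r zero    rewrite +-identityʳ k = refl
  remaining-suc k r (suc j) rewrite +-suc k j = remaining-suc (suc k) (r ∸ r % suc k) j

  remaining-hole-split : ∀ k r j →
    remaining k r j ≡ remaining k r j % suc (k + j) + remaining k r (suc j)
  remaining-hole-split k r j = sym (begin
    rest % suc (k + j) + remaining k r (suc j)     ≡⟨ cong (rest % suc (k + j) +_) (remaining-suc k r j) ⟩
    rest % suc (k + j) + (rest ∸ rest % suc (k + j)) ≡⟨ m+[n∸m]≡n (m%n≤m rest (suc (k + j))) ⟩
    rest                                           ∎)
    where rest = remaining k r j

  remaining-empty : ∀ k j → remaining k 0 j ≡ 0
  remaining-empty k zero    = refl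
  remaining-empty k (suc j) = remaining-empty (suc k) j

  remaining-≤ : ∀ k r j → remaining k r j ≤ r
  remaining-≤ k r zero    = ≤-refl
  remaining-≤ k r (suc j) = ≤-trans (remaining-≤ (suc k) (r ∸ r % suc k) j) (m∸n≤m r (r % suc k))

  remaining-divisible : ∀ k r j → suc (k + j) ∣ remaining k r (suc j)
  remaining-divisible k r j =
    divides (rest / suc (k + j)) (trans (remaining-suc k r j) (m∸m%n≡m/n*n rest (suc (k + j))))
    where rest = remaining k r j

  remaining-vanishes : ∀ r → remaining 1 r (suc r) ≡ 0
  remaining-vanishes r = begin
    rest                 ≡⟨ m<n⇒m%n≡m rest<r+2 ⟨
    rest % suc (suc r)   ≡⟨ n∣m⇒m%n≡0 rest (suc (suc r)) (remaining-divisible 1 r r) ⟩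
    0                    ∎
    where
    rest = remaining 1 r (suc r)
    rest<r+2 : rest < suc (suc r)
    rest<r+2 = s≤s (≤-trans (remaining-≤ 1 r (suc r)) (n≤1+n r))

  at-tchoukGo : ∀ f k r → remaining k r f ≡ 0 →
                ∀ j → at (tchoukGo f k r) (suc j) ≡ remaining k r j % suc (k + j)
  at-tchoukGo zero    k r       refl j       rewrite remaining-empty k j = refl
  at-tchoukGo (suc f) k zero    _    j       rewrite remaining-empty k j = refl
  at-tchoukGo (suc f) k (suc r) _    zero    rewrite +-identityʳ k = refl
  at-tchoukGo (suc f) k (suc r) done (suc j) rewrite +-suc k j = at-tchoukGo f (suc k) _ done j

  length-tchoukGo : ∀ f k r t → remaining k r f ≡ 0 → remaining k r t ≡ 0 →
                    (∀ j → j < t → 0 < remaining k r j) → length (tchoukGo f k r) ≡ t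
  length-tchoukGo zero    k r       zero    _    refl _ = refl
  length-tchoukGo (suc f) k r       zero    _    refl _ = refl
  length-tchoukGo f       k zero    (suc t) _    _    positive = ⊥-elim (n≮n 0 (positive 0 z<s))
  length-tchoukGo zero    k (suc r) (suc t) ()   _    _
  length-tchoukGo (suc f) k (suc r) (suc t) done stop positive =
    cong suc (length-tchoukGo f (suc k) _ t done stop (λ j j<t → positive (suc j) (s≤s j<t)))

  Tchouk-hole : ∀ m j → at (Tchouk m) (suc j) ≡ remaining 1 m j % suc (suc j)
  Tchouk-hole m = at-tchoukGo (suc m) 1 m (remaining-vanishes m)

  length-Tchouk : ∀ m t → remaining 1 m t ≡ 0 → (∀ j → j < t → 0 < remaining 1 m j) →
                  length (Tchouk m) ≡ t
  length-Tchouk m t = length-tchoukGo (suc m) 1 m t (remaining-vanishes m)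

  range-cons : ∀ {i j} → i ≤ j → range i j ≡ i ∷ range (suc i) j
  range-cons i≤j rewrite +-∸-assoc 1 i≤j = refl

  range-empty : ∀ j → range (suc j) j ≡ []
  range-empty j rewrite n∸n≡0 j = refl

  sumFromTo-telescope : ∀ m j d →
    sumFromTo (Tchouk m) (suc j) (j + d) + remaining 1 m (j + d) ≡ remaining 1 m j
  sumFromTo-telescope m j zero
    rewrite +-identityʳ j | range-empty j = refl
  sumFromTo-telescope m j (suc d) = begin
    sumFromTo b (suc j) (j + suc d) + remaining 1 m (j + suc d)
      ≡⟨ cong (λ t → sumFromTo b (suc j) t + remaining 1 m t) (+-suc j d) ⟩
    sumFromTo b (suc j) (suc j + d) + remaining 1 m (suc j + d)
      ≡⟨ cong (λ l → sum (map (at b) l) + remaining 1 m (suc j + d)) (range-cons (s≤s (m≤m+n j d))) ⟩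
    at b (suc j) + sumFromTo b (suc (suc j)) (suc j + d) + remaining 1 m (suc j + d)
      ≡⟨ +-assoc (at b (suc j)) _ _ ⟩
    at b (suc j) + (sumFromTo b (suc (suc j)) (suc j + d) + remaining 1 m (suc j + d))
      ≡⟨ cong₂ _+_ (Tchouk-hole m j) (sumFromTo-telescope m (suc j) d) ⟩
    remaining 1 m j % suc (suc j) + remaining 1 m (suc j)
      ≡⟨ remaining-hole-split 1 m j ⟨
    remaining 1 m j
      ∎
    where
    b = Tchouk m

  sumFromTo-Tchouk : ∀ m j t → j ≤ t → remaining 1 m t ≡ 0 →
                     sumFromTo (Tchouk m) (suc j) t ≡ remaining 1 m j
  sumFromTo-Tchouk m j t j≤t stop = begin
    sumFromTo (Tchouk m) (suc j) t                      ≡⟨ +-identityʳ _ ⟨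
    sumFromTo (Tchouk m) (suc j) t + 0                  ≡⟨ cong (sumFromTo (Tchouk m) (suc j) t +_) stop ⟨
    sumFromTo (Tchouk m) (suc j) t + remaining 1 m t
      ≡⟨ cong (λ u → sumFromTo (Tchouk m) (suc j) u + remaining 1 m u) (m+[n∸m]≡n j≤t) ⟨
    sumFromTo (Tchouk m) (suc j) (j + (t ∸ j)) + remaining 1 m (j + (t ∸ j))
      ≡⟨ sumFromTo-telescope m j (t ∸ j) ⟩
    remaining 1 m j                                     ∎

module Alist where

  open import Data.Nat
  open import Data.Nat.Properties
  open import Data.Nat.DivMod
  open import Data.Nat.Divisibility using (divides)
  open import Data.Nat.Tactic.RingSolver using (solve-∀)
  open import Relation.Binary.PropositionalEquality
  open Tchoukaillon

  alistStep-invariant : ∀ i y x → i * y ≡ i * i + x →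
                        suc i * alistStep i y ≡ suc i * suc i + (x ∸ x % suc i)
  alistStep-invariant i y x eq = begin
    suc i * (i * (y + 1) / suc i + 1)               ≡⟨ cong (λ z → suc i * (z / suc i + 1)) numerator ⟩
    suc i * ((x + i * suc i) / suc i + 1)           ≡⟨ cong (λ z → suc i * (z + 1)) (+-distrib-/-∣ʳ x (divides i refl)) ⟩
    suc i * (x / suc i + i * suc i / suc i + 1)     ≡⟨ cong (λ z → suc i * (x / suc i + z + 1)) (m*n/n≡m i (suc i)) ⟩
    suc i * (x / suc i + i + 1)                     ≡⟨ expand (x / suc i) i ⟩
    suc i * suc i + x / suc i * suc i               ≡⟨ cong (suc i * suc i +_) (m∸m%n≡m/n*n x (suc i)) ⟨
    suc i * suc i + (x ∸ x % suc i)                 ∎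
    where
    open ≡-Reasoning
    regroup : ∀ i x → i * i + x + i * 1 ≡ x + i * suc i
    regroup = solve-∀
    expand : ∀ q i → suc i * (q + i + 1) ≡ suc i * suc i + q * suc i
    expand = solve-∀
    numerator : i * (y + 1) ≡ x + i * suc i
    numerator = trans (*-distribˡ-+ i y 1) (trans (cong (_+ i * 1) eq) (regroup i x))

  alistY-invariant : ∀ m j → suc j * alistY (suc m) (suc j) ≡ suc j * suc j + remaining 1 m j
  alistY-invariant m zero    = +-identityʳ (suc m)
  alistY-invariant m (suc j) =
    trans (alistStep-invariant (suc j) _ _ (alistY-invariant m j))
          (cong (suc (suc j) * suc (suc j) +_) (sym (remaining-suc 1 m j)))

  excess≡ : ∀ {i y x} → i * y ≡ i * i + x → x ≡ i * (y ∸ i)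
  excess≡ {i} {y} {x} eq = begin
    x                  ≡⟨ m+n∸m≡n (i * i) x ⟨
    i * i + x ∸ i * i  ≡⟨ cong (_∸ i * i) eq ⟨
    i * y ∸ i * i      ≡⟨ *-distribˡ-∸ i y i ⟨
    i * (y ∸ i)        ∎
    where open ≡-Reasoning

  excess≡0 : ∀ {i y x} → i * y ≡ i * i + x → y ≤ i → x ≡ 0
  excess≡0 {i} {y} eq y≤i = trans (excess≡ {i} {y} eq) (trans (cong (i *_) (m≤n⇒m∸n≡0 y≤i)) (*-zeroʳ i))

  excess≥ : ∀ {i y x} → i * y ≡ i * i + x → i < y → i ≤ x
  excess≥ {i} {y} {x} eq i<y = begin
    i            ≡⟨ *-identityʳ i ⟨
    i * 1        ≤⟨ *-monoʳ-≤ i (m<n⇒0<n∸m i<y) ⟩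
    i * (y ∸ i)  ≡⟨ excess≡ {i} {y} eq ⟨
    x            ∎
    where open ≤-Reasoning

  alistY-stops : ∀ m j → alistY (suc m) (suc j) ≤ suc j → remaining 1 m j ≡ 0
  alistY-stops m j = excess≡0 (alistY-invariant m j)

  alistY-continues : ∀ m j → suc j < alistY (suc m) (suc j) → 0 < remaining 1 m j
  alistY-continues m j y>i = ≤-trans (s≤s z≤n) (excess≥ (alistY-invariant m j) y>i)

  alistY-hole : ∀ m j → let i = suc j in
    2 * i + 1 + i * alistY (suc m) i ≡ at (Tchouk m) i + suc i * alistY (suc m) (suc i)
  alistY-hole m j = begin
    2 * i + 1 + i * alistY (suc m) i                 ≡⟨ cong (2 * i + 1 +_) (alistY-invariant m j) ⟩
    2 * i + 1 + (i * i + remaining 1 m j)            ≡⟨ cong (λ r → 2 * i + 1 + (i * i + r)) (remaining-hole-split 1 m j) ⟩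
    2 * i + 1 + (i * i + (b + remaining 1 m i))      ≡⟨ regroup i b (remaining 1 m i) ⟩
    b + (suc i * suc i + remaining 1 m i)            ≡⟨ cong₂ _+_ (Tchouk-hole m j) (alistY-invariant m i) ⟨
    at (Tchouk m) i + suc i * alistY (suc m) (suc i) ∎
    where
    open ≡-Reasoning
    i = suc j
    b = remaining 1 m j % suc i
    regroup : ∀ i b r → 2 * i + 1 + (i * i + (b + r)) ≡ b + (suc i * suc i + r)
    regroup = solve-∀

  alistY-tail-sum : ∀ m j t → j ≤ t → remaining 1 m t ≡ 0 →
    suc j * alistY (suc m) (suc j) ≡ suc j * suc j + sumFromTo (Tchouk m) (suc j) t
  alistY-tail-sum m j t j≤t stop =
    trans (alistY-invariant m j) (cong (suc j * suc j +_) (sym (sumFromTo-Tchouk m j t j≤t stop)))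

open import Data.Nat using (ℕ; _≤_; _∸_; suc; s≤s; z≤n)
import Data.Nat as ℕ
open import Data.Nat.Properties using (m≤n+m; m+n∸n≡m; +-comm)
open import Data.Integer using (+_; _+_; _-_; _*_; _⊖_)
open import Data.Integer.Properties using (pos-+; pos-*; m-n≡m⊖n; ⊖-≥)
open import Data.List using (length)
open import Data.Product using (_×_; _,_)
open import Relation.Binary.PropositionalEquality using (_≡_; sym; trans; cong; cong₂; module ≡-Reasoning)
open Tchoukaillon
open Alist

pos-difference : ∀ i y z b → 2 ℕ.* i ℕ.+ 1 ℕ.+ i ℕ.* y ≡ b ℕ.+ suc i ℕ.* z →
                 + 2 * + i + + 1 + + i * + y - (+ i + + 1) * + z ≡ + b
pos-difference i y z b eq = begin
  + 2 * + i + + 1 + + i * + y - (+ i + + 1) * + z  ≡⟨ cong₂ _-_ left right ⟨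
  + (2 ℕ.* i ℕ.+ 1 ℕ.+ i ℕ.* y) - + c              ≡⟨ cong (λ a → + a - + c) eq ⟩
  + (b ℕ.+ c) - + c                                ≡⟨ m-n≡m⊖n (b ℕ.+ c) c ⟩
  (b ℕ.+ c) ⊖ c                                    ≡⟨ ⊖-≥ (m≤n+m c b) ⟩
  + (b ℕ.+ c ℕ.∸ c)                                ≡⟨ cong +_ (m+n∸n≡m b c) ⟩
  + b                                              ∎
  where
  open ≡-Reasoning
  c = suc i ℕ.* z
  left : + (2 ℕ.* i ℕ.+ 1 ℕ.+ i ℕ.* y) ≡ + 2 * + i + + 1 + + i * + y
  left = trans (pos-+ (2 ℕ.* i ℕ.+ 1) (i ℕ.* y))
               (cong₂ _+_ (trans (pos-+ (2 ℕ.* i) 1) (cong (_+ + 1) (pos-* 2 i))) (pos-* i y))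
  right : + c ≡ (+ i + + 1) * + z
  right = trans (pos-* (suc i) z) (cong (_* + z) (trans (cong +_ (+-comm 1 i)) (pos-+ i 1)))

pos-square-plus : ∀ i y s → i ℕ.* y ≡ i ℕ.* i ℕ.+ s → + i * + y ≡ + i * + i + + s
pos-square-plus i y s eq = begin
  + i * + y          ≡⟨ pos-* i y ⟨
  + (i ℕ.* y)        ≡⟨ cong +_ eq ⟩
  + (i ℕ.* i ℕ.+ s)  ≡⟨ pos-+ (i ℕ.* i) s ⟩
  + (i ℕ.* i) + + s  ≡⟨ cong (_+ + s) (pos-* i i) ⟩
  + i * + i + + s    ∎
  where open ≡-Reasoning

theorem3p3 : (n : ℕ) → 2 ≤ n → (s : ℕ) → IsStrangeRoot n s →
    (length (Tchouk (n ∸ 1)) ≡ s ∸ 1)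
    × ((i : ℕ) → 1 ≤ i → i ≤ s ∸ 1 →
        + at (Tchouk (n ∸ 1)) i
          ≡ + 2 * + i + + 1 + + i * + alistY n i - (+ i + + 1) * + alistY n (Data.Nat.suc i))
    × ((i : ℕ) → 1 ≤ i → i ≤ s →
        + i * + alistY n i ≡ + i * + i + + sumFromTo (Tchouk (n ∸ 1)) i (s ∸ 1))
theorem3p3 (suc m) _ (suc t) (_ , continues , stops) = length≡ , holes , tail-sums
  where
  stop : remaining 1 m t ≡ 0
  stop = alistY-stops m t stops
  length≡ : length (Tchouk m) ≡ t
  length≡ = length-Tchouk m t stop
    (λ j j<t → alistY-continues m j (continues (suc j) (s≤s z≤n) (s≤s j<t)))
  holes : ∀ i → 1 ≤ i → i ≤ t →
    + at (Tchouk m) i ≡ + 2 * + i + + 1 + + i * + alistY (suc m) i - (+ i + + 1) * + alistY (suc m) (suc i)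
  holes (suc j) _ _ = sym (pos-difference (suc j) _ _ _ (alistY-hole m j))
  tail-sums : ∀ i → 1 ≤ i → i ≤ suc t →
    + i * + alistY (suc m) i ≡ + i * + i + + sumFromTo (Tchouk m) i t
  tail-sums (suc j) _ (s≤s j≤t) = pos-square-plus (suc j) _ _ (alistY-tail-sum m j t j≤t stop)
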